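{- The poset $(\mathcal{F}_{\mathrm{ord}}(n),\le)$ is isomorphic to the Tamari lattice $\mathrm{Tam}_n$.
   Context: $\mathrm{Tam}_n$ may be realized as the set $\mathrm{Av}_n(312)$ of $312$-avoiding permutations of $[n]$ (no $i_1<i_2<i_3$ with $\sigma(i_1)>\sigma(i_3)>\sigma(i_2)$) with the order induced from the right weak order on $S_n$ (in which $\sigma$ covers $\sigma\circ(i\ i+1)$ whenever $\sigma(i)>\sigma(i+1)$). An ordered forest is a forest of rooted trees where the children of each vertex are linearly ordered left to right and the trees are ordered left to right; $\mathcal{F}_{\mathrm{ord}}(n)$ is the set of ordered forests on $n$ vertices up to isomorphism. Vertices are identified with their left-to-right preorder traversal labels (root of leftmost tree is $1$; each vertex is followed by its subtrees visited left to right, then the next tree). The operation on a vertex $v$ gives $F[v]$: if $v$ is a leaf, $F[v]=F$; otherwise, with $v'$ the rightmost child of $v$, delete the edge $v\to v'$ and either make $v'$ a child of the parent $w$ of $v$ immediately to the right of $v$ (if $w$ exists), or make the tree rooted at $v'$ a new tree immediately to the right of the tree containing $v$ (if $v$ is a root). $F'\lessdot F$ means $F'$ is obtained from $F$ by operating on a non-leaf vertex, and $\le$ is the reflexive-transitive closure of $\lessdot$. -}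

module Defs where

open import Data.Nat using (ℕ; zero; suc; _+_; _<?_)
open import Data.Fin as Fin using (Fin)
open import Data.List using (List; []; _∷_; _++_; unsnoc)
open import Data.Vec using (Vec; []; _∷_; lookup)
open import Data.Maybe using (Maybe; just; nothing)
open import Data.Product using (Σ; _×_; _,_; proj₁)
open import Data.Empty using (⊥)
open import Relation.Nullary using (¬_; yes; no)
open import Relation.Binary.PropositionalEquality using (_≡_)
open import Relation.Binary.Construct.Closure.ReflexiveTransitive using (Star)
open import Function.Definitions using (Injective)
open import Data.Nat using (_∸_)

-- These are canonical representatives of isomorphism
-- classes of ordered forests, so ≡ is "isomorphic".

data Tree : Set where
  node : List Tree → Tree

Forest : Set
Forest = List Tree

sizeT : Tree → ℕ
sizeF : Forest → ℕ
sizeT (node cs) = suc (sizeF cs)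
sizeF []       = 0
sizeF (t ∷ ts) = sizeT t + sizeF ts

FOrd : ℕ → Set
FOrd n = Σ Forest (λ F → sizeF F ≡ n)

-- Vertices are indexed by 0-based preorder position k inside a list of
-- siblings (the preorder label of the paper is k + 1).

childrenAt : Forest → ℕ → Maybe Forest
childrenAt []              k       = nothing
childrenAt (node cs ∷ ts) zero    = just cs
childrenAt (node cs ∷ ts) (suc k) with k <? sizeF cs
... | yes _ = childrenAt cs k
... | no  _ = childrenAt ts (k ∸ sizeF cs)

-- The operation at the vertex at 0-based preorder position k:
-- cut the rightmost child v' of v and insert it immediately to the
-- right of v in v's list of siblings (for a root v, the list of
-- siblings is the forest itself, so v' becomes a new tree right after
-- the tree of v).  Leaves (and nonexistent vertices) are unchanged.
opAt : Forest → ℕ → Forest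
opAt []              k       = []
opAt (node cs ∷ ts) zero with unsnoc cs
... | nothing         = node cs ∷ ts
... | just (init , v') = node init ∷ v' ∷ ts
opAt (node cs ∷ ts) (suc k) with k <? sizeF cs
... | yes _ = node (opAt cs k) ∷ ts
... | no  _ = node cs ∷ opAt ts (k ∸ sizeF cs)

op : Forest → ℕ → Forest
op F zero    = F
op F (suc k) = opAt F k

NonLeaf : Forest → ℕ → Set
NonLeaf F zero    = ⊥
NonLeaf F (suc k) = Σ Tree λ c → Σ Forest λ cs → childrenAt F k ≡ just (c ∷ cs)

_⋖F_ : Forest → Forest → Set
F' ⋖F F = Σ ℕ λ v → NonLeaf F v × F' ≡ op F v

_≤F_ : Forest → Forest → Set
_≤F_ = Star _⋖F_

-- Permutations of [n] in one-line notation, with values in Fin n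
-- (i.e. {0,…,n-1} instead of {1,…,n}); σ(i) = lookup σ i.

IsPerm : {n : ℕ} → Vec (Fin n) n → Set
IsPerm σ = Injective _≡_ _≡_ (lookup σ)

Avoids312 : {n : ℕ} → Vec (Fin n) n → Set
Avoids312 {n} σ = (i j k : Fin n) → i Fin.< j → j Fin.< k →
  ¬ ((lookup σ k Fin.< lookup σ i) × (lookup σ j Fin.< lookup σ k))

Av312 : ℕ → Set
Av312 n = Σ (Vec (Fin n) n) λ σ → IsPerm σ × Avoids312 σ

-- σ ∘ (i i+1) in one-line notation: swap the entries at positions i,i+1
swapAdj : {A : Set} {m : ℕ} → Vec A m → ℕ → Vec A m
swapAdj (x ∷ y ∷ xs) zero    = y ∷ x ∷ xs
swapAdj (x ∷ xs)     (suc i) = x ∷ swapAdj xs i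
swapAdj xs           _       = xs

DescentAt : {n m : ℕ} → Vec (Fin n) m → ℕ → Set
DescentAt (x ∷ y ∷ xs) zero    = y Fin.< x
DescentAt (x ∷ xs)     (suc i) = DescentAt xs i
DescentAt _            _       = ⊥

_⋖W_ : {n : ℕ} → Vec (Fin n) n → Vec (Fin n) n → Set
τ ⋖W σ = Σ ℕ λ i → DescentAt σ i × τ ≡ swapAdj σ i

_≤W_ : {n : ℕ} → Vec (Fin n) n → Vec (Fin n) n → Set
_≤W_ = Star _⋖W_

_≤Tam_ : {n : ℕ} → Av312 n → Av312 n → Set
σ ≤Tam τ = proj₁ σ ≤W proj₁ τ

_≤FOrd_ : {n : ℕ} → FOrd n → FOrd n → Set
F ≤FOrd G = proj₁ F ≤F proj₁ G

-- Poset isomorphism between FOrd n and Av312 n: mutually inverse maps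
-- (inverse on the underlying forest / permutation; the attached
-- proofs are propositions) that preserve and reflect the order.

record PosetIso (n : ℕ) : Set where
  field
    to       : FOrd n → Av312 n
    from     : Av312 n → FOrd n
    from∘to  : ∀ F → proj₁ (from (to F)) ≡ proj₁ F
    to∘from  : ∀ σ → proj₁ (to (from σ)) ≡ proj₁ σ
    to-mono  : ∀ F G → F ≤FOrd G → to F ≤Tam to G
    to-refl  : ∀ F G → to F ≤Tam to G → F ≤FOrd G

-- Send a forest to the word listing the preorder labels of its vertices
-- in postorder.  In this word a pair of labels a < b is inverted exactly
-- when b is a proper descendant of a; as the descendants of a vertex form
-- an interval of labels starting right after it, the word avoids 312, and
-- conversely a 312-avoiding word is read back as a forest by splitting it
-- at its smallest letter.  Operating on v moves the letter v to the left
-- past the block of its rightmost subtree, all of whose labels exceed v,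
-- which is a chain of covers in the right weak order.  Conversely the weak
-- order only enlarges inversion sets, and a forest whose descendant pairs
-- are among those of a forest G of the same size lies below G: cutting G
-- after as many vertices as the first tree of F has, the two forests can
-- be compared tree by tree.

module Submission where

open import Defs
open import Data.Nat using (ℕ; zero; suc; _+_; _∸_; _≤_; _<_; z≤n; s≤s; _<?_; _≤?_; _≟_)
open import Data.Nat.Properties
open import Data.Fin as Fin using (Fin; zero; suc; toℕ; fromℕ<; punchOut)
open import Data.Fin.Properties using (toℕ-injective; toℕ<n; toℕ-fromℕ<; any?; punchOut-injective; injective⇒≤)
import Data.Fin.Properties as Finₚ
open import Data.Vec as Vec using (Vec; []; _∷_; lookup; toList)
open import Data.Vec.Properties using (length-toList)
open import Data.List using (List; []; _∷_; _++_; _∷ʳ_; [_]; length; unsnoc; initLast; _∷ʳ′_)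
open import Data.List.Properties using (++-assoc; ++-identityʳ; length-++; ∷ʳ-injective; ++-conicalʳ)
open import Data.List.Membership.Propositional using (_∈_; _∉_)
open import Data.List.Membership.Propositional.Properties using (∈-++⁺ˡ; ∈-++⁺ʳ; ∈-++⁻; ∈-∃++)
open import Data.List.Relation.Unary.Any using (here; there)
open import Data.List.Relation.Unary.All as All using (All)
open import Data.List.Relation.Unary.All.Properties using (¬Any⇒All¬) renaming (++⁻ to All-++⁻)
open import Data.List.Relation.Unary.Unique.Propositional using (Unique; []; _∷_)
open import Data.List.Relation.Unary.Unique.Propositional.Properties using (Unique[x∷xs]⇒x∉xs)
import Data.List.Relation.Unary.Unique.Propositional.Properties as Unique
open import Data.List.Relation.Binary.Disjoint.Propositional using (Disjoint)
open import Data.List.Extrema.Nat using (max; ⊥≤max; xs≤max; argmax-sel)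
open import Data.Maybe as Maybe using (Maybe; just; nothing)
open import Data.Product as Product using (∃; ∃₂; _×_; _,_; proj₁; proj₂)
open import Data.Sum using (_⊎_; inj₁; inj₂)
open import Data.Empty using (⊥-elim)
open import Relation.Nullary using (¬_; yes; no)
open import Relation.Binary using (tri<; tri≈; tri>)
open import Relation.Binary.PropositionalEquality hiding ([_])
open import Relation.Binary.Construct.Closure.ReflexiveTransitive using (Star; ε; _◅_; _◅◅_; gmap)
open import Function using (id)
open import Function.Definitions using (Injective)

suc-+-assoc : ∀ m n o → suc (m + n) + o ≡ m + suc (n + o)
suc-+-assoc m n o = trans (cong suc (+-assoc m n o)) (sym (+-suc m (n + o)))

-- Forests and the operation

sizeF-++ : ∀ F G → sizeF (F ++ G) ≡ sizeF F + sizeF G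
sizeF-++ []            G = refl
sizeF-++ (node cs ∷ F) G =
  cong suc (trans (cong (sizeF cs +_) (sizeF-++ F G)) (sym (+-assoc (sizeF cs) (sizeF F) (sizeF G))))

sizeF-∷ʳ : ∀ F t → sizeF (F ∷ʳ t) ≡ sizeF F + sizeT t
sizeF-∷ʳ F t = trans (sizeF-++ F [ t ]) (cong (sizeF F +_) (+-identityʳ (sizeT t)))

unsnoc-just : ∀ {A : Set} (xs : List A) {ys y} → unsnoc xs ≡ just (ys , y) → xs ≡ ys ∷ʳ y
unsnoc-just xs eq with initLast xs
unsnoc-just .(zs ∷ʳ z) refl | zs ∷ʳ′ z = refl

unsnoc-nothing : ∀ {A : Set} (xs : List A) → unsnoc xs ≡ nothing → xs ≡ []
unsnoc-nothing xs eq with initLast xs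
unsnoc-nothing .[] refl | [] = refl

unsnoc-∷ʳ : ∀ {A : Set} (xs : List A) x → unsnoc (xs ∷ʳ x) ≡ just (xs , x)
unsnoc-∷ʳ xs x with unsnoc (xs ∷ʳ x) in eq
... | nothing with () ← ++-conicalʳ xs [ x ] (unsnoc-nothing (xs ∷ʳ x) eq)
... | just (ys , y) with refl , refl ← ∷ʳ-injective xs ys (unsnoc-just (xs ∷ʳ x) eq) = refl

opAt-root : ∀ cs v F → opAt (node (cs ∷ʳ v) ∷ F) zero ≡ node cs ∷ v ∷ F
opAt-root cs v F rewrite unsnoc-∷ʳ cs v = refl

childrenAt-inside : ∀ cs F k → k < sizeF cs → childrenAt (node cs ∷ F) (suc k) ≡ childrenAt cs k
childrenAt-inside cs F k k<cs with k <? sizeF cs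
... | yes _   = refl
... | no k≮cs = ⊥-elim (k≮cs k<cs)

opAt-inside : ∀ cs F k → k < sizeF cs → opAt (node cs ∷ F) (suc k) ≡ node (opAt cs k) ∷ F
opAt-inside cs F k k<cs with k <? sizeF cs
... | yes _   = refl
... | no k≮cs = ⊥-elim (k≮cs k<cs)

childrenAt-beside : ∀ cs F k → childrenAt (node cs ∷ F) (suc (sizeF cs + k)) ≡ childrenAt F k
childrenAt-beside cs F k with sizeF cs + k <? sizeF cs
... | yes lt = ⊥-elim (m+n≮m (sizeF cs) k lt)
... | no _   = cong (childrenAt F) (m+n∸m≡n (sizeF cs) k)

opAt-beside : ∀ cs F k → opAt (node cs ∷ F) (suc (sizeF cs + k)) ≡ node cs ∷ opAt F k
opAt-beside cs F k with sizeF cs + k <? sizeF cs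
... | yes lt = ⊥-elim (m+n≮m (sizeF cs) k lt)
... | no _   = cong (λ j → node cs ∷ opAt F j) (m+n∸m≡n (sizeF cs) k)

childrenAt-just⇒< : ∀ F k {cs} → childrenAt F k ≡ just cs → k < sizeF F
childrenAt-just⇒< []            k       ()
childrenAt-just⇒< (node cs ∷ F) zero    _ = s≤s z≤n
childrenAt-just⇒< (node cs ∷ F) (suc k) eq with k <? sizeF cs
... | yes k<cs = s≤s (≤-trans k<cs (m≤m+n _ _))
... | no k≮cs  = s≤s (begin-strict
  k                                ≡⟨ m+[n∸m]≡n (≮⇒≥ k≮cs) ⟨
  sizeF cs + (k ∸ sizeF cs)        <⟨ +-monoʳ-< (sizeF cs) (childrenAt-just⇒< F (k ∸ sizeF cs) eq) ⟩
  sizeF cs + sizeF F               ∎)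
  where open ≤-Reasoning

sizeF-opAt : ∀ F k → sizeF (opAt F k) ≡ sizeF F
sizeF-opAt []            k = refl
sizeF-opAt (node cs ∷ F) zero with initLast cs
... | []          = refl
... | init ∷ʳ′ v =
  cong suc (begin
    sizeF init + (sizeT v + sizeF F)  ≡⟨ +-assoc (sizeF init) (sizeT v) (sizeF F) ⟨
    sizeF init + sizeT v + sizeF F    ≡⟨ cong (_+ sizeF F) (sizeF-∷ʳ init v) ⟨
    sizeF (init ∷ʳ v) + sizeF F       ∎)
  where open ≡-Reasoning
sizeF-opAt (node cs ∷ F) (suc k) with k <? sizeF cs
... | yes _ = cong (λ s → suc (s + sizeF F)) (sizeF-opAt cs k)
... | no _  = cong (λ s → suc (sizeF cs + s)) (sizeF-opAt F _)

≤F-sizeF : ∀ {F G} → F ≤F G → sizeF F ≡ sizeF G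
≤F-sizeF ε                                         = refl
≤F-sizeF ((zero , () , _) ◅ _)
≤F-sizeF (_◅_ {j = H} (suc k , _ , refl) H≤G) = trans (sizeF-opAt H k) (≤F-sizeF H≤G)

⋖F-inside : ∀ {cs′ cs} F → cs′ ⋖F cs → (node cs′ ∷ F) ⋖F (node cs ∷ F)
⋖F-inside F (zero , () , _)
⋖F-inside {cs = cs} F (suc k , (c , cs″ , ch) , refl) =
  suc (suc k) , (c , cs″ , trans (childrenAt-inside cs F k k<cs) ch) , sym (opAt-inside cs F k k<cs)
  where k<cs = childrenAt-just⇒< cs k ch

⋖F-beside : ∀ cs {F′ F} → F′ ⋖F F → (node cs ∷ F′) ⋖F (node cs ∷ F)
⋖F-beside cs (zero , () , _)
⋖F-beside cs {F = F} (suc k , (c , cs′ , ch) , refl) =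
  suc (suc (sizeF cs + k)) , (c , cs′ , trans (childrenAt-beside cs F k) ch) , sym (opAt-beside cs F k)

≤F-inside : ∀ {cs′ cs} F → cs′ ≤F cs → (node cs′ ∷ F) ≤F (node cs ∷ F)
≤F-inside F = gmap (λ cs → node cs ∷ F) (⋖F-inside F)

≤F-beside : ∀ cs {F′ F} → F′ ≤F F → (node cs ∷ F′) ≤F (node cs ∷ F)
≤F-beside cs = gmap (node cs ∷_) (⋖F-beside cs)

root-⋖F : ∀ cs v F → (node cs ∷ v ∷ F) ⋖F (node (cs ∷ʳ v) ∷ F)
root-⋖F []       v F = 1 , (v , [] , refl) , sym (opAt-root [] v F)
root-⋖F (c ∷ cs) v F = 1 , (c , cs ∷ʳ v , refl) , sym (opAt-root (c ∷ cs) v F)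

≤F-release : ∀ cs′ cs F → (node cs ∷ cs′ ++ F) ≤F (node (cs ++ cs′) ∷ F)
≤F-release []        cs F = subst (λ ds → (node cs ∷ F) ≤F (node ds ∷ F)) (sym (++-identityʳ cs)) ε
≤F-release (v ∷ cs′) cs F =
  root-⋖F cs v (cs′ ++ F) ◅
  subst (λ ds → (node (cs ∷ʳ v) ∷ cs′ ++ F) ≤F (node ds ∷ F)) (++-assoc cs [ v ] cs′) (≤F-release cs′ (cs ∷ʳ v) F)

-- Postorder words

children-bound : ∀ o cs F → suc o + sizeF cs ≤ o + sizeF (node cs ∷ F)
children-bound o cs F = ≤-trans (s≤s (+-monoʳ-≤ o (m≤m+n (sizeF cs) (sizeF F)))) (≤-reflexive (sym (+-suc o _)))

postorder : ℕ → Forest → List ℕ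
postorder o []            = []
postorder o (node cs ∷ F) = postorder (suc o) cs ++ o ∷ postorder (suc (o + sizeF cs)) F

postorder-++ : ∀ o F G → postorder o (F ++ G) ≡ postorder o F ++ postorder (o + sizeF F) G
postorder-++ o []            G = cong (λ o′ → postorder o′ G) (sym (+-identityʳ o))
postorder-++ o (node cs ∷ F) G = begin
  postorder (suc o) cs ++ o ∷ postorder o′ (F ++ G)
    ≡⟨ cong (λ w → postorder (suc o) cs ++ o ∷ w) (postorder-++ o′ F G) ⟩
  postorder (suc o) cs ++ o ∷ postorder o′ F ++ postorder (o′ + sizeF F) G
    ≡⟨ cong (λ o″ → postorder (suc o) cs ++ o ∷ postorder o′ F ++ postorder o″ G) (suc-+-assoc o (sizeF cs) (sizeF F)) ⟩
  postorder (suc o) cs ++ o ∷ postorder o′ F ++ postorder (o + sizeF (node cs ∷ F)) G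
    ≡⟨ ++-assoc (postorder (suc o) cs) (o ∷ postorder o′ F) _ ⟨
  postorder o (node cs ∷ F) ++ postorder (o + sizeF (node cs ∷ F)) G ∎
  where
  open ≡-Reasoning
  o′ = suc (o + sizeF cs)

length-postorder : ∀ o F → length (postorder o F) ≡ sizeF F
length-postorder o []            = refl
length-postorder o (node cs ∷ F) =
  trans (length-++ (postorder (suc o) cs))
        (trans (cong₂ (λ m n → m + suc n) (length-postorder (suc o) cs) (length-postorder _ F))
               (+-suc (sizeF cs) (sizeF F)))

∈-postorder⁻ : ∀ o F {x} → x ∈ postorder o F → o ≤ x × x < o + sizeF F
∈-postorder⁻ o (node cs ∷ F) {x} x∈ with ∈-++⁻ (postorder (suc o) cs) x∈
... | inj₁ x∈cs with o<x , x<cs ← ∈-postorder⁻ (suc o) cs x∈cs = <⇒≤ o<x , ≤-trans x<cs (children-bound o cs F)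
... | inj₂ (here refl) = ≤-refl , m<m+n o (s≤s z≤n)
... | inj₂ (there x∈F) with o′≤x , x<F ← ∈-postorder⁻ _ F x∈F =
  ≤-trans (n≤1+n o) (≤-trans (s≤s (m≤m+n o (sizeF cs))) o′≤x) ,
  ≤-trans x<F (≤-reflexive (suc-+-assoc o (sizeF cs) (sizeF F)))

∈-postorder⁺ : ∀ o F {x} → o ≤ x → x < o + sizeF F → x ∈ postorder o F
∈-postorder⁺ o []            o≤x x<o = ⊥-elim (<⇒≱ x<o (≤-trans (≤-reflexive (+-identityʳ o)) o≤x))
∈-postorder⁺ o (node cs ∷ F) {x} o≤x x<o+F with <-cmp x o
... | tri< x<o _ _ = ⊥-elim (<⇒≱ x<o o≤x)
... | tri≈ _ refl _ = ∈-++⁺ʳ (postorder (suc o) cs) (here refl)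
... | tri> _ _ o<x with x <? suc o + sizeF cs
...   | yes x<cs = ∈-++⁺ˡ (∈-postorder⁺ (suc o) cs o<x x<cs)
...   | no x≮cs  = ∈-++⁺ʳ (postorder (suc o) cs)
  (there (∈-postorder⁺ _ F (≮⇒≥ x≮cs) (≤-trans x<o+F (≤-reflexive (sym (suc-+-assoc o (sizeF cs) (sizeF F)))))))

postorder-unique : ∀ o F → Unique (postorder o F)
postorder-unique o []            = []
postorder-unique o (node cs ∷ F) =
  Unique.++⁺ (postorder-unique (suc o) cs) (¬Any⇒All¬ _ o∉F ∷ postorder-unique _ F) disjoint
  where
  o∉F : o ∉ postorder (suc (o + sizeF cs)) F
  o∉F o∈F = <⇒≱ (s≤s (m≤m+n o (sizeF cs))) (proj₁ (∈-postorder⁻ _ F o∈F))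
  disjoint : Disjoint (postorder (suc o) cs) (o ∷ postorder (suc (o + sizeF cs)) F)
  disjoint (x∈cs , here refl)  = <-irrefl refl (proj₁ (∈-postorder⁻ _ cs x∈cs))
  disjoint (x∈cs , there x∈F) = <⇒≱ (proj₂ (∈-postorder⁻ _ cs x∈cs)) (proj₁ (∈-postorder⁻ _ F x∈F))

data Precedes {A : Set} : List A → A → A → Set where
  first : ∀ {x y l} → y ∈ l → Precedes (x ∷ l) x y
  later : ∀ {w x y l} → Precedes l x y → Precedes (w ∷ l) x y

module _ {A : Set} where

  Precedes⇒∈ : ∀ {l} {x y : A} → Precedes l x y → y ∈ l
  Precedes⇒∈ (first y∈l) = there y∈l
  Precedes⇒∈ (later p)   = there (Precedes⇒∈ p)

  Precedes-++ˡ : ∀ {l₁ l₂} {x y : A} → Precedes l₁ x y → Precedes (l₁ ++ l₂) x y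
  Precedes-++ˡ (first y∈l) = first (∈-++⁺ˡ y∈l)
  Precedes-++ˡ (later p)   = later (Precedes-++ˡ p)

  Precedes-++ʳ : ∀ l₁ {l₂} {x y : A} → Precedes l₂ x y → Precedes (l₁ ++ l₂) x y
  Precedes-++ʳ []       p = p
  Precedes-++ʳ (_ ∷ l₁) p = later (Precedes-++ʳ l₁ p)

  Precedes-++ : ∀ {l₁ l₂} {x y : A} → x ∈ l₁ → y ∈ l₂ → Precedes (l₁ ++ l₂) x y
  Precedes-++ {_ ∷ l₁} (here refl) y∈l₂ = first (∈-++⁺ʳ l₁ y∈l₂)
  Precedes-++          (there x∈l₁) y∈l₂ = later (Precedes-++ x∈l₁ y∈l₂)

  Precedes-++⁻ : ∀ l₁ {l₂} {x y : A} → Precedes (l₁ ++ l₂) x y →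
                 Precedes l₁ x y ⊎ Precedes l₂ x y ⊎ (x ∈ l₁ × y ∈ l₂)
  Precedes-++⁻ []       p = inj₂ (inj₁ p)
  Precedes-++⁻ (_ ∷ l₁) (first y∈l) with ∈-++⁻ l₁ y∈l
  ... | inj₁ y∈l₁ = inj₁ (first y∈l₁)
  ... | inj₂ y∈l₂ = inj₂ (inj₂ (here refl , y∈l₂))
  Precedes-++⁻ (_ ∷ l₁) (later p) with Precedes-++⁻ l₁ p
  ... | inj₁ p₁               = inj₁ (later p₁)
  ... | inj₂ (inj₁ p₂)        = inj₂ (inj₁ p₂)
  ... | inj₂ (inj₂ (x∈ , y∈)) = inj₂ (inj₂ (there x∈ , y∈))

  Precedes-antisym : ∀ {l} {x y : A} → Unique l → Precedes l x y → Precedes l y x → x ≡ y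
  Precedes-antisym _         (first _)   (first _)   = refl
  Precedes-antisym u@(_ ∷ _) (first _)   (later p)   = ⊥-elim (Unique[x∷xs]⇒x∉xs u (Precedes⇒∈ p))
  Precedes-antisym u@(_ ∷ _) (later p)   (first _)   = ⊥-elim (Unique[x∷xs]⇒x∉xs u (Precedes⇒∈ p))
  Precedes-antisym (_ ∷ u)   (later p)   (later q)   = Precedes-antisym u p q

Inversion : List ℕ → ℕ → ℕ → Set
Inversion l a b = a < b × Precedes l b a

Avoids312ᴸ : List ℕ → Set
Avoids312ᴸ l = ∀ {x y z} → Precedes l x y → Precedes l y z → ¬ (z < x × y < z)

-- Descendants

-- Descendant o F a b: in F, with vertices labelled in preorder from o, the
-- vertex b is a proper descendant of the vertex a.
data Descendant : ℕ → Forest → ℕ → ℕ → Set where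
  under-root  : ∀ {o cs F b} → o < b → b ≤ o + sizeF cs → Descendant o (node cs ∷ F) o b
  in-children : ∀ {o cs F a b} → Descendant (suc o) cs a b → Descendant o (node cs ∷ F) a b
  in-siblings : ∀ {o cs F a b} → Descendant (suc (o + sizeF cs)) F a b → Descendant o (node cs ∷ F) a b

_≼[_]_ : Forest → ℕ → Forest → Set
F ≼[ o ] G = ∀ {a b} → Descendant o F a b → Descendant o G a b

Descendant-range : ∀ {o F a b} → Descendant o F a b → o ≤ a × a < b × b < o + sizeF F
Descendant-range {o} {node cs ∷ F} (under-root o<b b≤cs) = ≤-refl , o<b , ≤-trans (s≤s b≤cs) (children-bound o cs F)
Descendant-range {o} {node cs ∷ F} (in-children d) with o<a , a<b , b<cs ← Descendant-range d =
  <⇒≤ o<a , a<b , ≤-trans b<cs (children-bound o cs F)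
Descendant-range {o} {node cs ∷ F} (in-siblings d) with o′≤a , a<b , b<F ← Descendant-range d =
  ≤-trans (n≤1+n o) (≤-trans (s≤s (m≤m+n o (sizeF cs))) o′≤a) , a<b ,
  ≤-trans b<F (≤-reflexive (suc-+-assoc o (sizeF cs) (sizeF F)))

Descendant-interval : ∀ {o F a b z} → a < z → z < b → Descendant o F a b → Descendant o F a z
Descendant-interval a<z z<b (under-root _ b≤cs) = under-root a<z (≤-trans (<⇒≤ z<b) b≤cs)
Descendant-interval a<z z<b (in-children d)     = in-children (Descendant-interval a<z z<b d)
Descendant-interval a<z z<b (in-siblings d)     = in-siblings (Descendant-interval a<z z<b d)

Descendant-++ˡ : ∀ {o F} G {a b} → Descendant o F a b → Descendant o (F ++ G) a b
Descendant-++ˡ G (under-root o<b b≤cs) = under-root o<b b≤cs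
Descendant-++ˡ G (in-children d)       = in-children d
Descendant-++ˡ G (in-siblings d)       = in-siblings (Descendant-++ˡ G d)

Descendant-++ʳ : ∀ {o} F {G a b} → Descendant (o + sizeF F) G a b → Descendant o (F ++ G) a b
Descendant-++ʳ {o} []            {G} {a} {b} d = subst (λ o′ → Descendant o′ G a b) (+-identityʳ o) d
Descendant-++ʳ {o} (node cs ∷ F) {G} {a} {b} d =
  in-siblings (Descendant-++ʳ F (subst (λ o′ → Descendant o′ G a b) (sym (suc-+-assoc o (sizeF cs) (sizeF F))) d))

descendant⇒inversion : ∀ {o F a b} → Descendant o F a b → Inversion (postorder o F) a b
descendant⇒inversion d = proj₁ (proj₂ (Descendant-range d)) , precedes d
  where
  precedes : ∀ {o F a b} → Descendant o F a b → Precedes (postorder o F) b a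
  precedes {o} {node cs ∷ F} (under-root o<b b≤cs) =
    Precedes-++ (∈-postorder⁺ (suc o) cs o<b (s≤s b≤cs)) (here refl)
  precedes (in-children d)         = Precedes-++ˡ (precedes d)
  precedes {F = node cs ∷ _} (in-siblings d) = Precedes-++ʳ (postorder _ cs) (later (precedes d))

inversion⇒descendant : ∀ o F {a b} → Inversion (postorder o F) a b → Descendant o F a b
inversion⇒descendant o (node cs ∷ F) (a<b , p) with Precedes-++⁻ (postorder (suc o) cs) p
... | inj₁ p-cs                       = in-children (inversion⇒descendant (suc o) cs (a<b , p-cs))
... | inj₂ (inj₁ (first a∈F))         =
  ⊥-elim (<⇒≱ a<b (≤-trans (≤-trans (n≤1+n o) (s≤s (m≤m+n o _))) (proj₁ (∈-postorder⁻ _ F a∈F))))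
... | inj₂ (inj₁ (later p-F))         = in-siblings (inversion⇒descendant _ F (a<b , p-F))
... | inj₂ (inj₂ (b∈cs , here refl)) with o<b , b<cs ← ∈-postorder⁻ _ cs b∈cs = under-root o<b (≤-pred b<cs)
... | inj₂ (inj₂ (b∈cs , there a∈F)) =
  ⊥-elim (<⇒≱ a<b (≤-trans (<⇒≤ (proj₂ (∈-postorder⁻ _ cs b∈cs))) (proj₁ (∈-postorder⁻ _ F a∈F))))

postorder-avoids312 : ∀ o F → Avoids312ᴸ (postorder o F)
postorder-avoids312 o F x≺y y≺z (z<x , y<z) = <-irrefl (Precedes-antisym (postorder-unique o F) y≺z z≺y) y<z
  where
  x-under-y : Descendant o F _ _
  x-under-y = inversion⇒descendant o F (<-trans y<z z<x , x≺y)
  z≺y = proj₂ (descendant⇒inversion (Descendant-interval y<z z<x x-under-y))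

-- Comparing forests by their descendant pairs

-- Cutting G after its first p vertices in preorder: front ++ back lies
-- below G and keeps every descendant pair that does not straddle the cut.
record Split (o p : ℕ) (G : Forest) : Set where
  constructor cut
  field
    front back  : Forest
    size-front  : sizeF front ≡ p
    size-back   : sizeF front + sizeF back ≡ sizeF G
    below       : (front ++ back) ≤F G
    keeps-front : ∀ {a b} → Descendant o G a b → b < o + p → Descendant o front a b
    keeps-back  : ∀ {a b} → Descendant o G a b → o + p ≤ a → Descendant (o + p) back a b

split-zero : ∀ o G → Split o 0 G
split-zero o G = cut [] G refl refl ε keeps-front keeps-back
  where
  keeps-front : ∀ {a b} → Descendant o G a b → b < o + 0 → Descendant o [] a b
  keeps-front d b<o with o≤a , a<b , _ ← Descendant-range d =
    ⊥-elim (<⇒≱ b<o (≤-trans (≤-reflexive (+-identityʳ o)) (≤-trans o≤a (<⇒≤ a<b))))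
  keeps-back : ∀ {a b} → Descendant o G a b → o + 0 ≤ a → Descendant (o + 0) G a b
  keeps-back {a} {b} d _ = subst (λ o′ → Descendant o′ G a b) (sym (+-identityʳ o)) d

split-inside : ∀ {o p d} u → Split (suc o) p d → Split o (suc p) (node d ∷ u)
split-inside {o} {p} {d} u (cut d₁ d₂ size₁ size₂ below keeps₁ keeps₂) =
  cut [ node d₁ ] (d₂ ++ u) (cong suc (trans (+-identityʳ _) size₁)) size-back
      (≤F-release d₂ d₁ u ◅◅ ≤F-inside u below) keeps-front keeps-back
  where
  open ≡-Reasoning
  d≡p+d₂ : sizeF d ≡ p + sizeF d₂
  d≡p+d₂ = trans (sym size₂) (cong (_+ sizeF d₂) size₁)
  size-back : suc (sizeF d₁ + 0) + sizeF (d₂ ++ u) ≡ suc (sizeF d + sizeF u)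
  size-back = cong suc (begin
    sizeF d₁ + 0 + sizeF (d₂ ++ u)    ≡⟨ cong₂ _+_ (+-identityʳ (sizeF d₁)) (sizeF-++ d₂ u) ⟩
    sizeF d₁ + (sizeF d₂ + sizeF u)   ≡⟨ +-assoc (sizeF d₁) (sizeF d₂) (sizeF u) ⟨
    sizeF d₁ + sizeF d₂ + sizeF u     ≡⟨ cong (_+ sizeF u) size₂ ⟩
    sizeF d + sizeF u                 ∎)
  keeps-front : ∀ {a b} → Descendant o (node d ∷ u) a b → b < o + suc p → Descendant o [ node d₁ ] a b
  keeps-front {b = b} (under-root o<b _) b<     =
    under-root o<b (subst (λ s → b ≤ o + s) (sym size₁) (≤-pred (subst (b <_) (+-suc o p) b<)))
  keeps-front {b = b} (in-children x) b<       = in-children (keeps₁ x (subst (b <_) (+-suc o p) b<))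
  keeps-front {a} {b} (in-siblings x) b< with o′≤a , a<b , _ ← Descendant-range x =
    ⊥-elim (<⇒≱ (≤-trans o′≤a (≤-trans (<⇒≤ a<b) (≤-pred (subst (b <_) (+-suc o p) b<))))
                (+-monoʳ-≤ o (≤-trans (m≤m+n p (sizeF d₂)) (≤-reflexive (sym d≡p+d₂)))))
  keeps-back : ∀ {a b} → Descendant o (node d ∷ u) a b → o + suc p ≤ a → Descendant (o + suc p) (d₂ ++ u) a b
  keeps-back (under-root _ _) o+p<o = ⊥-elim (<⇒≱ (m<m+n o (s≤s z≤n)) o+p<o)
  keeps-back {a} {b} (in-children x) p≤a =
    Descendant-++ˡ u (subst (λ o′ → Descendant o′ d₂ a b) (sym (+-suc o p)) (keeps₂ x (subst (_≤ a) (+-suc o p) p≤a)))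
  keeps-back {a} {b} (in-siblings x) _ = Descendant-++ʳ d₂ (subst (λ o′ → Descendant o′ u a b) offset x)
    where
    offset : suc (o + sizeF d) ≡ o + suc p + sizeF d₂
    offset = begin
      suc (o + sizeF d)            ≡⟨ cong (λ s → suc (o + s)) d≡p+d₂ ⟩
      suc (o + (p + sizeF d₂))     ≡⟨ cong suc (+-assoc o p (sizeF d₂)) ⟨
      suc (o + p) + sizeF d₂       ≡⟨ cong (_+ sizeF d₂) (+-suc o p) ⟨
      o + suc p + sizeF d₂         ∎

split-beside : ∀ {o p} d {u} → sizeF d ≤ p → Split (suc (o + sizeF d)) (p ∸ sizeF d) u → Split o (suc p) (node d ∷ u)
split-beside {o} {p} d {u} d≤p (cut u₁ u₂ size₁ size₂ below keeps₁ keeps₂) =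
  cut (node d ∷ u₁) u₂ (cong suc (trans (cong (sizeF d +_) size₁) (m+[n∸m]≡n d≤p)))
      (cong suc (trans (+-assoc (sizeF d) (sizeF u₁) (sizeF u₂)) (cong (sizeF d +_) size₂)))
      (≤F-beside d below) keeps-front keeps-back
  where
  offset : suc (o + sizeF d) + (p ∸ sizeF d) ≡ o + suc p
  offset = trans (suc-+-assoc o (sizeF d) (p ∸ sizeF d)) (cong (λ s → o + suc s) (m+[n∸m]≡n d≤p))
  keeps-front : ∀ {a b} → Descendant o (node d ∷ u) a b → b < o + suc p → Descendant o (node d ∷ u₁) a b
  keeps-front (under-root o<b b≤d) _  = under-root o<b b≤d
  keeps-front (in-children x) _       = in-children x
  keeps-front {b = b} (in-siblings x) b< = in-siblings (keeps₁ x (subst (b <_) (sym offset) b<))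
  keeps-back : ∀ {a b} → Descendant o (node d ∷ u) a b → o + suc p ≤ a → Descendant (o + suc p) u₂ a b
  keeps-back (under-root _ _) o+p<o = ⊥-elim (<⇒≱ (m<m+n o (s≤s z≤n)) o+p<o)
  keeps-back (in-children x) p≤a with _ , a<b , b<d ← Descendant-range x =
    ⊥-elim (<⇒≱ (<-trans a<b b<d) (≤-trans (s≤s (+-monoʳ-≤ o d≤p)) (≤-trans (≤-reflexive (sym (+-suc o p))) p≤a)))
  keeps-back {a} {b} (in-siblings x) p≤a =
    subst (λ o′ → Descendant o′ u₂ a b) offset (keeps₂ x (subst (_≤ a) (sym offset) p≤a))

split : ∀ o p G → p ≤ sizeF G → Split o p G
split o zero    G            _   = split-zero o G
split o (suc p) (node d ∷ u) p<G with p ≤? sizeF d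
... | yes p≤d = split-inside u (split (suc o) p d p≤d)
... | no p≰d  = split-beside d d≤p (split (suc (o + sizeF d)) (p ∸ sizeF d) u (m≤n+o⇒m∸n≤o p (sizeF d) (≤-pred p<G)))
  where d≤p = <⇒≤ (≰⇒> p≰d)

first-tree-≤ : ∀ {o c t d u} → (node c ∷ t) ≼[ o ] (node d ∷ u) → sizeF c ≤ sizeF d
first-tree-≤ {c = []} _ = z≤n
first-tree-≤ {o} {c = c@(node _ ∷ _)} F≼G with F≼G (under-root {cs = c} (m<m+n o (s≤s z≤n)) ≤-refl)
... | under-root _ o+c≤o+d = +-cancelˡ-≤ o _ _ o+c≤o+d
... | in-children x = ⊥-elim (<-irrefl refl (proj₁ (Descendant-range x)))
... | in-siblings x = ⊥-elim (<⇒≱ (s≤s (m≤m+n o _)) (proj₁ (Descendant-range x)))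

≼⇒≤F : ∀ {o} F G → sizeF F ≡ sizeF G → F ≼[ o ] G → F ≤F G
≼⇒≤F []           []           _    _   = ε
≼⇒≤F []           (node _ ∷ _) ()   _
≼⇒≤F (node _ ∷ _) []           ()   _
≼⇒≤F {o} (node c ∷ t) (node d ∷ u) same F≼G
  with cut d₁ d₂ size₁ size₂ below keeps₁ keeps₂ ← split (suc o) (sizeF c) d (first-tree-≤ F≼G) =
  -- node c ∷ t ≤ node d₁ ∷ t ≤ node d₁ ∷ d₂ ++ u ≤ node (d₁ ++ d₂) ∷ u ≤ node d ∷ u
  ≤F-inside t (≼⇒≤F c d₁ (sym size₁) c≼d₁) ◅◅ ≤F-beside d₁ (≼⇒≤F t (d₂ ++ u) size-rest t≼rest) ◅◅
  ≤F-release d₂ d₁ u ◅◅ ≤F-inside u below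
  where
  open ≡-Reasoning
  d≡c+d₂ : sizeF d ≡ sizeF c + sizeF d₂
  d≡c+d₂ = trans (sym size₂) (cong (_+ sizeF d₂) size₁)
  size-rest : sizeF t ≡ sizeF (d₂ ++ u)
  size-rest = +-cancelˡ-≡ (sizeF c) _ _ (begin
    sizeF c + sizeF t               ≡⟨ suc-injective same ⟩
    sizeF d + sizeF u               ≡⟨ cong (_+ sizeF u) d≡c+d₂ ⟩
    sizeF c + sizeF d₂ + sizeF u    ≡⟨ +-assoc (sizeF c) (sizeF d₂) (sizeF u) ⟩
    sizeF c + (sizeF d₂ + sizeF u)  ≡⟨ cong (sizeF c +_) (sizeF-++ d₂ u) ⟨
    sizeF c + sizeF (d₂ ++ u)       ∎)
  c≼d₁ : c ≼[ suc o ] d₁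
  c≼d₁ x with F≼G (in-children x)
  ... | under-root _ _ = ⊥-elim (<-irrefl refl (proj₁ (Descendant-range x)))
  ... | in-children y  = keeps₁ y (proj₂ (proj₂ (Descendant-range x)))
  ... | in-siblings y with _ , a<b , b<c ← Descendant-range x =
    ⊥-elim (<⇒≱ (<-trans a<b b<c) (≤-trans (s≤s (+-monoʳ-≤ o (first-tree-≤ F≼G))) (proj₁ (Descendant-range y))))
  t≼rest : t ≼[ suc (o + sizeF c) ] (d₂ ++ u)
  t≼rest x with F≼G (in-siblings x)
  ... | under-root _ _ = ⊥-elim (<⇒≱ (s≤s (m≤m+n o _)) (proj₁ (Descendant-range x)))
  ... | in-children y  = Descendant-++ˡ u (keeps₂ y (proj₁ (Descendant-range x)))
  ... | in-siblings {a = a} {b} y = Descendant-++ʳ d₂ (subst (λ o′ → Descendant o′ u a b) offset y)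
    where
    offset : suc (o + sizeF d) ≡ suc (o + sizeF c) + sizeF d₂
    offset = cong suc (trans (cong (o +_) d≡c+d₂) (sym (+-assoc o (sizeF c) (sizeF d₂))))

-- Covers of forests as left shifts of words

record LeftShift (w w′ : List ℕ) : Set where
  constructor shift
  field
    A B C  : List ℕ
    x      : ℕ
    before : w ≡ A ++ B ++ x ∷ C
    after  : w′ ≡ A ++ x ∷ B ++ C
    larger : ∀ {y} → y ∈ B → x < y

LeftShift-∷ : ∀ y {w w′} → LeftShift w w′ → LeftShift (y ∷ w) (y ∷ w′)
LeftShift-∷ y (shift A B C x before after larger) = shift (y ∷ A) B C x (cong (y ∷_) before) (cong (y ∷_) after) larger

LeftShift-++ˡ : ∀ P {w w′} → LeftShift w w′ → LeftShift (P ++ w) (P ++ w′)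
LeftShift-++ˡ []      s = s
LeftShift-++ˡ (y ∷ P) s = LeftShift-∷ y (LeftShift-++ˡ P s)

LeftShift-++ʳ : ∀ R {w w′} → LeftShift w w′ → LeftShift (w ++ R) (w′ ++ R)
LeftShift-++ʳ R (shift A B C x before after larger) = shift A B (C ++ R) x
  (trans (cong (_++ R) before) (trans (++-assoc A (B ++ x ∷ C) R) (cong (A ++_) (++-assoc B (x ∷ C) R))))
  (trans (cong (_++ R) after) (trans (++-assoc A (x ∷ B ++ C) R) (cong (λ v → A ++ x ∷ v) (++-assoc B C R))))
  larger

postorder-opAt : ∀ o F k → NonLeaf F (suc k) → LeftShift (postorder o F) (postorder o (opAt F k))
postorder-opAt o [] k (_ , _ , ())
postorder-opAt o (node cs ∷ F) zero nonleaf with initLast cs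
postorder-opAt o (node .[] ∷ F) zero (_ , _ , ()) | []
postorder-opAt o (node .(cs ∷ʳ v) ∷ F) zero _ | cs ∷ʳ′ v =
  shift (postorder (suc o) cs) B C o
    (trans (cong (_++ o ∷ C) (postorder-++ (suc o) cs [ v ])) (++-assoc (postorder (suc o) cs) B (o ∷ C)))
    (cong (λ w → postorder (suc o) cs ++ o ∷ w) (trans (postorder-++ (suc (o + sizeF cs)) [ v ] F) (cong (λ o′ → B ++ postorder o′ F) offset)))
    λ y∈B → ≤-trans (s≤s (m≤m+n o (sizeF cs))) (proj₁ (∈-postorder⁻ _ [ v ] y∈B))
  where
  B = postorder (suc (o + sizeF cs)) [ v ]
  C = postorder (suc (o + sizeF (cs ∷ʳ v))) F
  offset : suc (o + sizeF cs) + sizeF [ v ] ≡ suc (o + sizeF (cs ∷ʳ v))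
  offset = cong suc (trans (+-assoc o (sizeF cs) _) (cong (o +_) (sym (sizeF-++ cs [ v ]))))
postorder-opAt o (node cs ∷ F) (suc k) nonleaf with k <? sizeF cs
... | yes _ rewrite sizeF-opAt cs k =
  LeftShift-++ʳ (o ∷ postorder (suc (o + sizeF cs)) F) (postorder-opAt (suc o) cs k nonleaf)
... | no _ = LeftShift-++ˡ (postorder (suc o) cs) (LeftShift-∷ o (postorder-opAt _ F (k ∸ sizeF cs) nonleaf))

-- Reading a forest back from its postorder word

length-++-∷ : ∀ {A : Set} (xs : List A) {x ys} → length (xs ++ x ∷ ys) ≡ suc (length xs + length ys)
length-++-∷ xs {x} {ys} = trans (length-++ xs) (+-suc (length xs) (length ys))

splitOn : ℕ → List ℕ → Maybe (List ℕ × List ℕ)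
splitOn x []      = nothing
splitOn x (y ∷ w) with x ≟ y
... | yes _ = just ([] , w)
... | no _  = Maybe.map (Product.map₁ (y ∷_)) (splitOn x w)

splitOn-++ : ∀ x A C → x ∉ A → splitOn x (A ++ x ∷ C) ≡ just (A , C)
splitOn-++ x []      C _ with x ≟ x
... | yes _   = refl
... | no x≢x = ⊥-elim (x≢x refl)
splitOn-++ x (y ∷ A) C x∉A with x ≟ y
... | yes refl = ⊥-elim (x∉A (here refl))
... | no _ rewrite splitOn-++ x A C (λ x∈A → x∉A (there x∈A)) = refl

-- The letter o splits the postorder word of a forest with labels from o
-- into the words of the children of the first root and of the other trees;
-- the first argument is fuel.
build : ℕ → ℕ → List ℕ → Forest
build zero    o w = []
build (suc k) o w with splitOn o w
... | nothing      = []
... | just (A , C) = node (build k (suc o) A) ∷ build k (suc (o + sizeF (build k (suc o) A))) C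

build-[] : ∀ k o → build k o [] ≡ []
build-[] zero    o = refl
build-[] (suc k) o = refl

build-postorder : ∀ k o F → sizeF F ≤ k → build k o (postorder o F) ≡ F
build-postorder k       o []            _ = build-[] k o
build-postorder (suc k) o (node cs ∷ F) (s≤s cs+F≤k)
  rewrite splitOn-++ o (postorder (suc o) cs) (postorder (suc (o + sizeF cs)) F) (λ o∈cs → <-irrefl refl (proj₁ (∈-postorder⁻ _ cs o∈cs)))
        | build-postorder k (suc o) cs (m+n≤o⇒m≤o _ cs+F≤k)
        | build-postorder k (suc (o + sizeF cs)) F (m+n≤o⇒n≤o _ cs+F≤k) = refl

record Arrangement (o e : ℕ) (w : List ℕ) : Set where
  field
    unique   : Unique w
    bounded  : ∀ {x} → x ∈ w → o ≤ x × x < e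
    complete : ∀ {x} → o ≤ x → x < e → x ∈ w

Unique-++⁻ : ∀ {A : Set} (xs : List A) {ys} → Unique (xs ++ ys) → Unique xs × Unique ys × Disjoint xs ys
Unique-++⁻ []       u = [] , u , λ ()
Unique-++⁻ (x ∷ xs) (x∉ ∷ u) with uxs , uys , disjoint ← Unique-++⁻ xs u =
  proj₁ (All-++⁻ xs x∉) ∷ uxs , uys , λ where
    (here refl , x∈ys) → All.lookup (proj₂ (All-++⁻ xs x∉)) x∈ys refl
    (there v∈xs , v∈ys) → disjoint (v∈xs , v∈ys)

Avoids312ᴸ-++ˡ : ∀ A {C} → Avoids312ᴸ (A ++ C) → Avoids312ᴸ A
Avoids312ᴸ-++ˡ A av p q = av (Precedes-++ˡ p) (Precedes-++ˡ q)

Avoids312ᴸ-++ʳ : ∀ A {C} → Avoids312ᴸ (A ++ C) → Avoids312ᴸ C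
Avoids312ᴸ-++ʳ A av p q = av (Precedes-++ʳ A p) (Precedes-++ʳ A q)

module Decomposition {o e A C} (arr : Arrangement o e (A ++ o ∷ C)) (av : Avoids312ᴸ (A ++ o ∷ C)) where
  open Arrangement arr

  private
    parts = Unique-++⁻ A unique

    disjoint : Disjoint A (o ∷ C)
    disjoint = proj₂ (proj₂ parts)

    o∉C : o ∉ C
    o∉C = Unique[x∷xs]⇒x∉xs (proj₁ (proj₂ parts))

    o≤ : ∀ {x} → x ∈ A ++ o ∷ C → o ≤ x
    o≤ x∈ = proj₁ (bounded x∈)

  o<A : ∀ {x} → x ∈ A → o < x
  o<A {x} x∈A with m≤n⇒m<n∨m≡n (o≤ (∈-++⁺ˡ x∈A))
  ... | inj₁ o<x  = o<x
  ... | inj₂ refl = ⊥-elim (disjoint (x∈A , here refl))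

  o<C : ∀ {y} → y ∈ C → o < y
  o<C {y} y∈C with m≤n⇒m<n∨m≡n (o≤ (∈-++⁺ʳ A (there y∈C)))
  ... | inj₁ o<y  = o<y
  ... | inj₂ refl = ⊥-elim (o∉C y∈C)

  -- Otherwise x, o, y would be an occurrence of 312.
  A<C : ∀ {x y} → x ∈ A → y ∈ C → x < y
  A<C {x} {y} x∈A y∈C with <-cmp x y
  ... | tri< x<y _ _  = x<y
  ... | tri≈ _ refl _ = ⊥-elim (disjoint (x∈A , there y∈C))
  ... | tri> _ _ y<x  = ⊥-elim (av (Precedes-++ x∈A (here refl)) (Precedes-++ʳ A (first y∈C)) (y<x , o<C y∈C))

  max<C : ∀ {y} → y ∈ C → max o A < y
  max<C y∈C with argmax-sel id o A
  ... | inj₁ max≡o = subst (_< _) (sym max≡o) (o<C y∈C)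
  ... | inj₂ max∈A = A<C max∈A y∈C

  max<e : max o A < e
  max<e with argmax-sel id o A
  ... | inj₁ max≡o = subst (_< e) (sym max≡o) (proj₂ (bounded (∈-++⁺ʳ A (here refl))))
  ... | inj₂ max∈A = proj₂ (bounded (∈-++⁺ˡ max∈A))

  left : Arrangement (suc o) (suc (max o A)) A
  left = record
    { unique   = proj₁ parts
    ; bounded  = λ x∈A → o<A x∈A , s≤s (All.lookup (xs≤max o A) x∈A)
    ; complete = complete-A
    }
    where
    complete-A : ∀ {y} → suc o ≤ y → y < suc (max o A) → y ∈ A
    complete-A o<y y≤max with ∈-++⁻ A (complete (<⇒≤ o<y) (≤-trans y≤max max<e))
    ... | inj₁ y∈A         = y∈A
    ... | inj₂ (here refl) = ⊥-elim (<-irrefl refl o<y)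
    ... | inj₂ (there y∈C) = ⊥-elim (<⇒≱ (max<C y∈C) (≤-pred y≤max))

  right : Arrangement (suc (max o A)) e C
  right = record
    { unique   = tail (proj₁ (proj₂ parts))
    ; bounded  = λ y∈C → max<C y∈C , proj₂ (bounded (∈-++⁺ʳ A (there y∈C)))
    ; complete = complete-C
    }
    where
    tail : Unique (o ∷ C) → Unique C
    tail (_ ∷ u) = u
    complete-C : ∀ {y} → suc (max o A) ≤ y → y < e → y ∈ C
    complete-C max<y y<e with ∈-++⁻ A (complete (≤-trans (≤-trans (⊥≤max o A) (n≤1+n _)) max<y) y<e)
    ... | inj₁ y∈A         = ⊥-elim (<⇒≱ (s≤s (All.lookup (xs≤max o A) y∈A)) max<y)
    ... | inj₂ (here refl) = ⊥-elim (<⇒≱ (s≤s (⊥≤max o A)) max<y)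
    ... | inj₂ (there y∈C) = y∈C

arrangement-empty : ∀ {o e w} → e ≤ o → Arrangement o e w → w ≡ []
arrangement-empty {w = []}    _   _   = refl
arrangement-empty {w = _ ∷ _} e≤o arr with o≤x , x<e ← Arrangement.bounded arr (here refl) =
  ⊥-elim (<⇒≱ x<e (≤-trans e≤o o≤x))

postorder-build-∷ : ∀ k {o e A C} → length (A ++ o ∷ C) ≤ k → Arrangement o e (A ++ o ∷ C) → Avoids312ᴸ (A ++ o ∷ C) →
  postorder o (build k o (A ++ o ∷ C)) ≡ A ++ o ∷ C × o + sizeF (build k o (A ++ o ∷ C)) ≡ e

postorder-build : ∀ k {o e w} → length w ≤ k → o ≤ e → Arrangement o e w → Avoids312ᴸ w →
  postorder o (build k o w) ≡ w × o + sizeF (build k o w) ≡ e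
postorder-build k {o} {e} len o≤e arr av with e ≤? o
... | yes e≤o with refl ← arrangement-empty e≤o arr rewrite build-[] k o =
  refl , trans (+-identityʳ o) (≤-antisym o≤e e≤o)
... | no e≰o with A , C , refl ← ∈-∃++ (Arrangement.complete arr ≤-refl (≰⇒> e≰o)) =
  postorder-build-∷ k len arr av

postorder-build-∷ zero    {A = A} len _ _ = ⊥-elim (<⇒≱ (s≤s z≤n) (≤-trans (≤-reflexive (sym (length-++-∷ A))) len))
postorder-build-∷ (suc k) {o} {e} {A} {C} len arr av
  rewrite splitOn-++ o A C (λ o∈A → <-irrefl refl (Decomposition.o<A arr av o∈A)) =
  let cs = build k (suc o) A
      A+C≤k = ≤-pred (≤-trans (≤-reflexive (sym (length-++-∷ A))) len)
      postA , endA = postorder-build k (m+n≤o⇒m≤o _ A+C≤k) (s≤s (⊥≤max o A)) left (Avoids312ᴸ-++ˡ A av)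
      postC , endC = postorder-build k (m+n≤o⇒n≤o _ A+C≤k) (subst (_≤ e) (sym endA) max<e)
                       (subst (λ t → Arrangement t e C) (sym endA) right) (Avoids312ᴸ-++ʳ [ o ] (Avoids312ᴸ-++ʳ A av))
  in cong₂ (λ a c → a ++ o ∷ c) postA postC , trans (sym (suc-+-assoc o (sizeF cs) _)) endC
  where open Decomposition arr av

-- Permutations as words

word : ∀ {k m} → Vec (Fin k) m → List ℕ
word v = toList (Vec.map toℕ v)

module _ {k : ℕ} where

  ∈-word⁺ : ∀ {m} (v : Vec (Fin k) m) i → toℕ (lookup v i) ∈ word v
  ∈-word⁺ (x ∷ v) zero    = here refl
  ∈-word⁺ (x ∷ v) (suc i) = there (∈-word⁺ v i)

  ∈-word⁻ : ∀ {m} (v : Vec (Fin k) m) {y} → y ∈ word v → ∃ λ i → toℕ (lookup v i) ≡ y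
  ∈-word⁻ (x ∷ v) (here refl) = zero , refl
  ∈-word⁻ (x ∷ v) (there y∈) = Product.map suc id (∈-word⁻ v y∈)

  Precedes-word⁺ : ∀ {m} (v : Vec (Fin k) m) {i j} → i Fin.< j →
                   Precedes (word v) (toℕ (lookup v i)) (toℕ (lookup v j))
  Precedes-word⁺ (x ∷ v) {zero}  {suc j} _         = first (∈-word⁺ v j)
  Precedes-word⁺ (x ∷ v) {suc i} {suc j} (s≤s i<j) = later (Precedes-word⁺ v i<j)

  Precedes-word⁻ : ∀ {m} (v : Vec (Fin k) m) {x y} → Precedes (word v) x y →
                   ∃₂ λ i j → i Fin.< j × toℕ (lookup v i) ≡ x × toℕ (lookup v j) ≡ y
  Precedes-word⁻ (x ∷ v) (first y∈) with j , refl ← ∈-word⁻ v y∈ = zero , suc j , s≤s z≤n , refl , refl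
  Precedes-word⁻ (x ∷ v) (later p) with i , j , i<j , refl , refl ← Precedes-word⁻ v p =
    suc i , suc j , s≤s i<j , refl , refl

  unique-word⇒injective : ∀ {m} (v : Vec (Fin k) m) → Unique (word v) → Injective _≡_ _≡_ (lookup v)
  unique-word⇒injective (x ∷ v) (x∉ ∷ u) {zero}  {zero}  _  = refl
  unique-word⇒injective (x ∷ v) (x∉ ∷ u) {zero}  {suc j} eq = ⊥-elim (All.lookup x∉ (∈-word⁺ v j) (cong toℕ eq))
  unique-word⇒injective (x ∷ v) (x∉ ∷ u) {suc i} {zero}  eq = ⊥-elim (All.lookup x∉ (∈-word⁺ v i) (cong toℕ (sym eq)))
  unique-word⇒injective (x ∷ v) (x∉ ∷ u) {suc i} {suc j} eq = cong suc (unique-word⇒injective v u eq)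

  injective⇒unique-word : ∀ {m} (v : Vec (Fin k) m) → Injective _≡_ _≡_ (lookup v) → Unique (word v)
  injective⇒unique-word []      _   = []
  injective⇒unique-word (x ∷ v) inj = ¬Any⇒All¬ _ x∉ ∷ injective⇒unique-word v (λ eq → Finₚ.suc-injective (inj eq))
    where
    x∉ : toℕ x ∉ word v
    x∉ x∈ with j , e ← ∈-word⁻ v x∈ = Finₚ.0≢1+n (inj (sym (toℕ-injective e)))

  ∈-word-swapAdj : ∀ {m} (v : Vec (Fin k) m) i {a} → a ∈ word (swapAdj v i) → a ∈ word v
  ∈-word-swapAdj []          i       a∈                 = a∈
  ∈-word-swapAdj (x ∷ [])    zero    a∈                 = a∈
  ∈-word-swapAdj (x ∷ [])    (suc i) a∈                 = a∈
  ∈-word-swapAdj (x ∷ y ∷ v) zero    (here e)           = there (here e)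
  ∈-word-swapAdj (x ∷ y ∷ v) zero    (there (here e))   = here e
  ∈-word-swapAdj (x ∷ y ∷ v) zero    (there (there a∈)) = there (there a∈)
  ∈-word-swapAdj (x ∷ y ∷ v) (suc i) (here e)           = here e
  ∈-word-swapAdj (x ∷ y ∷ v) (suc i) (there a∈)         = there (∈-word-swapAdj (y ∷ v) i a∈)

  Inversion-swapAdj : ∀ {m} (σ : Vec (Fin k) m) i → DescentAt σ i →
                      ∀ {a b} → Inversion (word (swapAdj σ i)) a b → Inversion (word σ) a b
  Inversion-swapAdj σ i desc {a} {b} (a<b , p) = a<b , precedes σ i desc p
    where
    precedes : ∀ {m} (σ : Vec (Fin k) m) i → DescentAt σ i → Precedes (word (swapAdj σ i)) b a → Precedes (word σ) b a
    precedes (x ∷ y ∷ v) zero    y<x (first (here refl))   = ⊥-elim (<-asym a<b y<x)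
    precedes (x ∷ y ∷ v) zero    _   (first (there a∈))   = later (first a∈)
    precedes (x ∷ y ∷ v) zero    _   (later (first a∈))   = first (there a∈)
    precedes (x ∷ y ∷ v) zero    _   (later (later p))    = later (later p)
    precedes (x ∷ y ∷ v) (suc i) _   (first a∈)           = first (∈-word-swapAdj (y ∷ v) i a∈)
    precedes (x ∷ y ∷ v) (suc i) d   (later p)            = later (precedes (y ∷ v) i d p)

≤W-inversions : ∀ {n} {σ τ : Vec (Fin n) n} → σ ≤W τ → ∀ {a b} → Inversion (word σ) a b → Inversion (word τ) a b
≤W-inversions ε                               inv = inv
≤W-inversions (_◅_ {j = ρ} (i , desc , refl) ρ≤τ) inv = ≤W-inversions ρ≤τ (Inversion-swapAdj ρ i desc inv)

Avoids312ᴸ⇒Avoids312 : ∀ {n} (σ : Vec (Fin n) n) → Avoids312ᴸ (word σ) → Avoids312 σ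
Avoids312ᴸ⇒Avoids312 σ av i j k i<j j<k = av (Precedes-word⁺ σ i<j) (Precedes-word⁺ σ j<k)

Avoids312⇒Avoids312ᴸ : ∀ {n} (σ : Vec (Fin n) n) → IsPerm σ → Avoids312 σ → Avoids312ᴸ (word σ)
Avoids312⇒Avoids312ᴸ σ inj av x≺y y≺z
  with i , j , i<j , refl , refl ← Precedes-word⁻ σ x≺y
     | j′ , k , j′<k , σj′≡σj , refl ← Precedes-word⁻ σ y≺z
  with refl ← inj (toℕ-injective σj′≡σj) = av i j k i<j j′<k

-- Pigeonhole: otherwise punching y out of f would inject Fin (suc n) into Fin n.
injective⇒surjective : ∀ {n} {f : Fin n → Fin n} → Injective _≡_ _≡_ f → ∀ y → ∃ λ i → f i ≡ y
injective⇒surjective {suc n} {f} inj y with any? (λ i → f i Fin.≟ y)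
... | yes hit = hit
... | no miss = ⊥-elim (<-irrefl refl (injective⇒≤ punchOut∘f-injective))
  where
  y≢f : ∀ i → y ≢ f i
  y≢f i eq = miss (i , sym eq)
  punchOut∘f-injective : Injective _≡_ _≡_ (λ i → punchOut (y≢f i))
  punchOut∘f-injective eq = inj (punchOut-injective (y≢f _) (y≢f _) eq)

word-arrangement : ∀ {n} (σ : Vec (Fin n) n) → IsPerm σ → Arrangement 0 n (word σ)
word-arrangement {n} σ inj = record
  { unique   = injective⇒unique-word σ inj
  ; bounded  = λ x∈ → z≤n , bounded x∈
  ; complete = complete
  }
  where
  bounded : ∀ {x} → x ∈ word σ → x < n
  bounded x∈ with i , refl ← ∈-word⁻ σ x∈ = toℕ<n (lookup σ i)
  complete : ∀ {x} → 0 ≤ x → x < n → x ∈ word σ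
  complete _ x<n with i , σi≡x ← injective⇒surjective inj (fromℕ< x<n) =
    subst (_∈ word σ) (trans (cong toℕ σi≡x) (toℕ-fromℕ< x<n)) (∈-word⁺ σ i)

postorder-build-word : ∀ {n} (σ : Vec (Fin n) n) → IsPerm σ → Avoids312 σ →
  postorder 0 (build n 0 (word σ)) ≡ word σ × sizeF (build n 0 (word σ)) ≡ n
postorder-build-word σ inj av =
  postorder-build _ (≤-reflexive (length-toList (Vec.map toℕ σ))) z≤n (word-arrangement σ inj) (Avoids312⇒Avoids312ᴸ σ inj av)

-- The isomorphism

clamp : (M x : ℕ) → Fin (suc M)
clamp M       zero    = zero
clamp zero    (suc x) = zero
clamp (suc M) (suc x) = suc (clamp M x)

toℕ-clamp : ∀ M {x} → x ≤ M → toℕ (clamp M x) ≡ x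
toℕ-clamp M       z≤n       = refl
toℕ-clamp (suc M) (s≤s x≤M) = cong suc (toℕ-clamp M x≤M)

clamp-toℕ : ∀ M (i : Fin (suc M)) → clamp M (toℕ i) ≡ i
clamp-toℕ M       zero    = refl
clamp-toℕ (suc M) (suc i) = cong suc (clamp-toℕ M i)

swapAdj-suc : ∀ {A : Set} {m} x (v : Vec A m) i → swapAdj (x ∷ v) (suc i) ≡ x ∷ swapAdj v i
swapAdj-suc x []      i = refl
swapAdj-suc x (_ ∷ _) i = refl

DescentAt-suc : ∀ {n m} (x : Fin n) (v : Vec (Fin n) m) i → DescentAt (x ∷ v) (suc i) ≡ DescentAt v i
DescentAt-suc x []      i = refl
DescentAt-suc x (_ ∷ _) i = refl

length-move : ∀ {A : Set} (xs ys : List A) x zs → length (xs ++ x ∷ ys ++ zs) ≡ length (xs ++ ys ++ x ∷ zs)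
length-move []       []       x zs = refl
length-move []       (_ ∷ ys) x zs = cong suc (length-move [] ys x zs)
length-move (_ ∷ xs) ys       x zs = cong suc (length-move xs ys x zs)

module _ (N : ℕ) where

  -- Letters above N are clamped and missing letters padded with 0, so only
  -- words of length m with all letters at most N are read faithfully.
  fromWord : (m : ℕ) → List ℕ → Vec (Fin (suc N)) m
  fromWord zero    _       = []
  fromWord (suc m) []      = zero ∷ fromWord m []
  fromWord (suc m) (x ∷ w) = clamp N x ∷ fromWord m w

  word-fromWord : ∀ w {m} → length w ≡ m → (∀ {x} → x ∈ w → x ≤ N) → word (fromWord m w) ≡ w
  word-fromWord []      refl _     = refl
  word-fromWord (x ∷ w) refl bound =
    cong₂ _∷_ (toℕ-clamp N (bound (here refl))) (word-fromWord w refl (λ y∈ → bound (there y∈)))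

  fromWord-word : ∀ {m} (v : Vec (Fin (suc N)) m) → fromWord m (word v) ≡ v
  fromWord-word []      = refl
  fromWord-word (x ∷ v) = cong₂ _∷_ (clamp-toℕ N x) (fromWord-word v)

  swapAdj-fromWord : ∀ A y x R {m} → length (A ++ y ∷ x ∷ R) ≡ m →
    swapAdj (fromWord m (A ++ y ∷ x ∷ R)) (length A) ≡ fromWord m (A ++ x ∷ y ∷ R)
  swapAdj-fromWord []      y x R refl = refl
  swapAdj-fromWord (a ∷ A) y x R refl =
    trans (swapAdj-suc (clamp N a) _ (length A)) (cong (clamp N a ∷_) (swapAdj-fromWord A y x R refl))

  DescentAt-fromWord : ∀ A y x R {m} → length (A ++ y ∷ x ∷ R) ≡ m → x < y → y ≤ N →
    DescentAt (fromWord m (A ++ y ∷ x ∷ R)) (length A)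
  DescentAt-fromWord []      y x R refl x<y y≤N =
    subst₂ _<_ (sym (toℕ-clamp N (≤-trans (<⇒≤ x<y) y≤N))) (sym (toℕ-clamp N y≤N)) x<y
  DescentAt-fromWord (a ∷ A) y x R refl x<y y≤N =
    subst id (sym (DescentAt-suc (clamp N a) (fromWord (length (A ++ y ∷ x ∷ R)) (A ++ y ∷ x ∷ R)) (length A))) (DescentAt-fromWord A y x R refl x<y y≤N)

  shift-≤W : ∀ B A x C → length (A ++ B ++ x ∷ C) ≡ suc N → (∀ {y} → y ∈ B → x < y × y ≤ N) →
    fromWord (suc N) (A ++ x ∷ B ++ C) ≤W fromWord (suc N) (A ++ B ++ x ∷ C)
  shift-≤W []      A x C _   _      = ε
  shift-≤W (y ∷ B) A x C len larger =
    step ◅ subst₂ _≤W_ (cong (fromWord (suc N)) (++-assoc A [ y ] _)) (cong (fromWord (suc N)) (++-assoc A [ y ] _))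
                  (shift-≤W B (A ∷ʳ y) x C (trans (cong length (++-assoc A [ y ] _)) len) (λ y∈B → larger (there y∈B)))
    where
    len′ : length (A ++ y ∷ x ∷ B ++ C) ≡ suc N
    len′ = begin
      length (A ++ y ∷ x ∷ B ++ C)     ≡⟨ cong length (++-assoc A [ y ] (x ∷ B ++ C)) ⟨
      length ((A ∷ʳ y) ++ x ∷ B ++ C)  ≡⟨ length-move (A ∷ʳ y) B x C ⟩
      length ((A ∷ʳ y) ++ B ++ x ∷ C)  ≡⟨ cong length (++-assoc A [ y ] (B ++ x ∷ C)) ⟩
      length (A ++ y ∷ B ++ x ∷ C)     ≡⟨ len ⟩
      suc N                            ∎
      where open ≡-Reasoning
    step : fromWord (suc N) (A ++ x ∷ y ∷ B ++ C) ⋖W fromWord (suc N) (A ++ y ∷ x ∷ B ++ C)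
    step = length A ,
           DescentAt-fromWord A y x (B ++ C) len′ (proj₁ (larger (here refl))) (proj₂ (larger (here refl))) ,
           sym (swapAdj-fromWord A y x (B ++ C) len′)

  LeftShift⇒≤W : ∀ {w w′} → LeftShift w w′ → length w ≡ suc N → (∀ {y} → y ∈ w → y ≤ N) →
    fromWord (suc N) w′ ≤W fromWord (suc N) w
  LeftShift⇒≤W (shift A B C x refl refl larger) len bound =
    shift-≤W B A x C len (λ y∈B → larger y∈B , bound (∈-++⁺ʳ A (∈-++⁺ˡ y∈B)))

  toPerm : Forest → Vec (Fin (suc N)) (suc N)
  toPerm F = fromWord (suc N) (postorder 0 F)

  postorder-≤ : ∀ F → sizeF F ≡ suc N → ∀ {x} → x ∈ postorder 0 F → x ≤ N
  postorder-≤ F size x∈ = ≤-pred (subst (_ <_) size (proj₂ (∈-postorder⁻ 0 F x∈)))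

  word-toPerm : ∀ F → sizeF F ≡ suc N → word (toPerm F) ≡ postorder 0 F
  word-toPerm F size = word-fromWord (postorder 0 F) (trans (length-postorder 0 F) size) (postorder-≤ F size)

  toAv : FOrd (suc N) → Av312 (suc N)
  toAv (F , size) =
    toPerm F ,
    unique-word⇒injective (toPerm F) (subst Unique (sym (word-toPerm F size)) (postorder-unique 0 F)) ,
    Avoids312ᴸ⇒Avoids312 (toPerm F) (subst Avoids312ᴸ (sym (word-toPerm F size)) (postorder-avoids312 0 F))

  fromAv : Av312 (suc N) → FOrd (suc N)
  fromAv (σ , inj , av) = build (suc N) 0 (word σ) , proj₂ (postorder-build-word σ inj av)

  ⋖F⇒≤W : ∀ {F G} → F ⋖F G → sizeF G ≡ suc N → toPerm F ≤W toPerm G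
  ⋖F⇒≤W         (zero , () , _)
  ⋖F⇒≤W {G = G} (suc k , nonleaf , refl) size =
    LeftShift⇒≤W (postorder-opAt 0 G k nonleaf) (trans (length-postorder 0 G) size) (postorder-≤ G size)

  ≤F⇒≤W : ∀ {F G} → F ≤F G → sizeF G ≡ suc N → toPerm F ≤W toPerm G
  ≤F⇒≤W ε         _    = ε
  ≤F⇒≤W (s ◅ H≤G) size = ⋖F⇒≤W s (trans (≤F-sizeF H≤G) size) ◅◅ ≤F⇒≤W H≤G size

  ≤W⇒≤F : ∀ F G → sizeF F ≡ suc N → sizeF G ≡ suc N → toPerm F ≤W toPerm G → F ≤F G
  ≤W⇒≤F F G sizeF sizeG F≤G = ≼⇒≤F F G (trans sizeF (sym sizeG)) F≼G
    where
    F≼G : F ≼[ 0 ] G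
    F≼G {a} {b} d = inversion⇒descendant 0 G (subst (λ w → Inversion w a b) (word-toPerm G sizeG)
      (≤W-inversions F≤G (subst (λ w → Inversion w a b) (sym (word-toPerm F sizeF)) (descendant⇒inversion d))))

  iso-suc : PosetIso (suc N)
  iso-suc = record
    { to      = toAv
    ; from    = fromAv
    ; from∘to = λ { (F , size) → trans (cong (build (suc N) 0) (word-toPerm F size)) (build-postorder (suc N) 0 F (≤-reflexive size)) }
    ; to∘from = λ { (σ , inj , av) → trans (cong (fromWord (suc N)) (proj₁ (postorder-build-word σ inj av))) (fromWord-word σ) }
    ; to-mono = λ { _ (_ , sizeG) F≤G → ≤F⇒≤W F≤G sizeG }
    ; to-refl = λ { (F , sizeF) (G , sizeG) → ≤W⇒≤F F G sizeF sizeG }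
    }

sizeF≡0 : ∀ {F} → sizeF F ≡ 0 → F ≡ []
sizeF≡0 {[]}           _  = refl
sizeF≡0 {node _ ∷ _} ()

iso-0 : PosetIso 0
iso-0 = record
  { to      = λ _ → [] , (λ { {()} }) , λ ()
  ; from    = λ _ → [] , refl
  ; from∘to = λ { (F , size) → sym (sizeF≡0 size) }
  ; to∘from = λ { ([] , _) → refl }
  ; to-mono = λ _ _ _ → ε
  ; to-refl = λ { (F , sizeF) (G , sizeG) _ → subst₂ _≤F_ (sym (sizeF≡0 sizeF)) (sym (sizeF≡0 sizeG)) ε }
  }

theorem4p7 : (n : ℕ) → PosetIso n
theorem4p7 zero    = iso-0
theorem4p7 (suc N) = iso-suc N
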